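{- Let $p$ be a prime with $7 \mid p-1$, and let $k,q$ be positive integers with $p\nmid q$ and $\mathrm{ord}_{p^k}(q) = 7$. Then $$m(q,p^k) = \begin{cases} 3, & \text{if } p=43 \text{ and } k=1,\\ 4, & \text{if } p\in\{29,71,547\} \text{ and } k=1,\\ 5, & \text{if } p\in\{113,197,421,463\} \text{ and } k=1,\\ 6, & \text{if } p\in\{211,379,449,757,2689\} \text{ and } k=1,\\ 7, & \text{otherwise.}\end{cases}$$
   Context: $\mathrm{ord}_e(q)$ denotes the multiplicative order of $q$ modulo $e$. For coprime positive integers $q,e$, $m(q,e)$ denotes the least positive integer $t$ such that there exist nonnegative integers $a_1,\ldots,a_t$ (repetitions allowed) with $q^{a_1}+\cdots+q^{a_t} \equiv 0 \pmod e$. -}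

module Defs where

open import Data.Nat using (ℕ; zero; suc; _+_; _*_; _∸_; _^_; _≤_; _<_)
open import Data.Nat.Divisibility using (_∣_)
open import Data.List using (List; []; _∷_; length; map)
open import Data.Nat.ListAction using (sum)
open import Data.Bool using (Bool; true; false; if_then_else_; _∧_; _∨_)
open import Data.Nat using (_≡ᵇ_)
open import Data.Product using (_×_; ∃-syntax)
open import Relation.Binary.PropositionalEquality using (_≡_)

IsLeastPositive : (ℕ → Set) → ℕ → Set
IsLeastPositive P n = (0 < n) × P n × (∀ t → 0 < t → P t → n ≤ t)

-- ord_e(q) = n : n is the least positive t with q^t ≡ 1 (mod e),
-- written as e ∣ q^t ∸ 1 (valid since q ≥ 1 so q^t ≥ 1).
IsOrd : ℕ → ℕ → ℕ → Set
IsOrd e q n = IsLeastPositive (λ t → e ∣ (q ^ t ∸ 1)) n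

HasZeroSumOfPowers : ℕ → ℕ → ℕ → Set
HasZeroSumOfPowers q e t = ∃[ as ] (length as ≡ t × e ∣ sum (map (q ^_) as))

IsM : ℕ → ℕ → ℕ → Set
IsM q e n = IsLeastPositive (HasZeroSumOfPowers q e) n

inList : ℕ → List ℕ → Bool
inList p [] = false
inList p (x ∷ xs) = (p ≡ᵇ x) ∨ inList p xs

expectedM : ℕ → ℕ → ℕ
expectedM p k =
  if (k ≡ᵇ 1) ∧ inList p (43 ∷ []) then 3
  else if (k ≡ᵇ 1) ∧ inList p (29 ∷ 71 ∷ 547 ∷ []) then 4
  else if (k ≡ᵇ 1) ∧ inList p (113 ∷ 197 ∷ 421 ∷ 463 ∷ []) then 5
  else if (k ≡ᵇ 1) ∧ inList p (211 ∷ 379 ∷ 449 ∷ 757 ∷ 2689 ∷ []) then 6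
  else 7

-- Write q = 1 + d. Then q⁷ − 1 = d·Φ₇(q) with Φ₇(q) = 1 + q + ⋯ + q⁶ ≡ 7 (mod d), and since p > 7
-- and pᵏ ∤ d this forces pᵏ ∣ Φ₇(q): the seven powers 1, q, …, q⁶ sum to 0 modulo pᵏ, so m ≤ 7.
-- Conversely, reducing exponents modulo 7 turns a zero sum of t ≤ 6 powers into c(q) ≡ 0 (mod pᵏ)
-- for some c ∈ ℕ[x]/(x⁷ − 1) with coefficient sum t. The norm of c, the product of the c(xʲ) for
-- j = 1, …, 6, is invariant under x ↦ xʲ and so equals r + m·Φ₇(x); evaluating at q gives pᵏ ∣ r.
-- Enumerating the finitely many c and factoring r shows that pᵏ ∣ r forces t ≥ m(q, pᵏ) as
-- claimed, except for pᵏ = 29², which is settled by a search over the seventh roots of unity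
-- modulo 841. The smaller values of m for the exceptional primes are witnessed by zero sums found
-- by a search over the seventh roots of unity modulo p.

module Submission where

open import Defs
open import Data.Nat using (ℕ; _∸_; _^_; _<_)
open import Data.Nat.Divisibility using (_∣_)
open import Data.Nat.Primality using (Prime)
open import Relation.Nullary using (¬_)

open import Data.Bool using (Bool; true; false; if_then_else_; _∧_; _∨_; not; T)
open import Data.Bool.ListAction using (all; any)
open import Data.Bool.Properties using (T-∧; T-∨; T-≡)
open import Data.List using (List; []; _∷_; _++_; length; map; replicate; upTo)
open import Data.List.Membership.Propositional using (_∈_; find)
open import Data.List.Membership.Propositional.Properties using (∈-upTo⁺; ∈-upTo⁻)
open import Data.List.Properties using (map-++; length-++; length-map; length-replicate)
open import Data.List.Relation.Unary.All as All using (All)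
open import Data.List.Relation.Unary.All.Properties using (all⁺)
open import Data.List.Relation.Unary.Any using (here; there)
open import Data.List.Relation.Unary.Any.Properties using (any⁻)
open import Data.Nat using (zero; suc; _+_; _*_; _≤_; _%_; _/_; _≡ᵇ_; _≤ᵇ_; NonZero; z≤n; s≤s; s≤s⁻¹; z<s; _≟_; _≤?_)
open import Data.Nat.DivMod
open import Data.Nat.Divisibility
open import Data.Nat.ListAction using (sum)
open import Data.Nat.ListAction.Properties using (sum-++)
open import Data.Nat.Primality
open import Data.Nat.Properties
open import Data.Nat.Tactic.RingSolver using (solve-∀)
open import Data.Product using (_×_; _,_; proj₁; proj₂; ∃-syntax)
open import Data.Sum using (_⊎_; inj₁; inj₂)
open import Data.Vec using (Vec; []; _∷_)
import Data.Vec as Vec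
import Data.Vec.Properties as Vec
open import Function using (_∘_)
open import Function.Bundles using (Equivalence; _⇔_; mk⇔)
open Equivalence using (to; from)
open import Relation.Binary.PropositionalEquality
open import Relation.Nullary using (yes; no; contradiction)
open import Relation.Nullary.Decidable using (⌊_⌋; toWitness; toWitnessFalse; from-yes)

eval : ∀ {n} → ℕ → Vec ℕ n → ℕ
eval q [] = 0
eval q (a ∷ v) = a + q * eval q v

ones : ∀ n → Vec ℕ n
ones n = Vec.replicate n 1

Φ₇ : ℕ → ℕ
Φ₇ q = eval q (ones 7)

eval-replicate : ∀ q n m → eval q (Vec.replicate n m) ≡ m * eval q (ones n)
eval-replicate q zero m = sym (*-zeroʳ m)
eval-replicate q (suc n) m = begin
  m + q * eval q (Vec.replicate n m) ≡⟨ cong (λ e → m + q * e) (eval-replicate q n m) ⟩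
  m + q * (m * eval q (ones n))      ≡⟨ factor m q (eval q (ones n)) ⟩
  m * (1 + q * eval q (ones n))      ∎
  where
  open ≡-Reasoning
  factor : ∀ m q e → m + q * (m * e) ≡ m * (1 + q * e)
  factor = solve-∀

eval-suc : ∀ d {n} (v : Vec ℕ n) → ∃[ h ] eval (suc d) v ≡ Vec.sum v + d * h
eval-suc d [] = 0 , sym (*-zeroʳ d)
eval-suc d (a ∷ v) with eval-suc d v
... | h , e = h + eval (suc d) v , (begin
  a + suc d * eval (suc d) v                    ≡⟨ cong (λ x → a + suc d * x) e ⟩
  a + (1 + d) * (Vec.sum v + d * h)             ≡⟨ regroup a d (Vec.sum v) h ⟩
  a + Vec.sum v + d * (h + (Vec.sum v + d * h)) ≡⟨ cong (λ x → a + Vec.sum v + d * (h + x)) (sym e) ⟩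
  a + Vec.sum v + d * (h + eval (suc d) v)      ∎)
  where
  open ≡-Reasoning
  regroup : ∀ a d s h → a + (1 + d) * (s + d * h) ≡ a + s + d * (h + (s + d * h))
  regroup = solve-∀

[1+d]^n≡1+d*eval-ones : ∀ d n → suc d ^ n ≡ 1 + d * eval (suc d) (ones n)
[1+d]^n≡1+d*eval-ones d zero = cong suc (sym (*-zeroʳ d))
[1+d]^n≡1+d*eval-ones d (suc n) = begin
  suc d * suc d ^ n                     ≡⟨ cong (suc d *_) ([1+d]^n≡1+d*eval-ones d n) ⟩
  (1 + d) * (1 + d * eval (suc d) (ones n)) ≡⟨ expand d (eval (suc d) (ones n)) ⟩
  1 + d * (1 + suc d * eval (suc d) (ones n)) ∎
  where
  open ≡-Reasoning
  expand : ∀ d e → (1 + d) * (1 + d * e) ≡ 1 + d * (1 + (1 + d) * e)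
  expand = solve-∀

∣d⇒∣Φ₇⇒∣7 : ∀ {m d} → m ∣ d → m ∣ Φ₇ (suc d) → m ∣ 7
∣d⇒∣Φ₇⇒∣7 {m} {d} m∣d m∣Φ = go (eval-suc d (ones 7))
  where
  go : ∃[ h ] Φ₇ (suc d) ≡ 7 + d * h → m ∣ 7
  go (h , e) = ∣m+n∣m⇒∣n (subst (m ∣_) (trans e (+-comm 7 (d * h))) m∣Φ) (∣m⇒∣m*n h m∣d)

-- Sums of powers and their exponent histograms

powerSum : ℕ → List ℕ → ℕ
powerSum q as = sum (map (q ^_) as)

powerSum-++ : ∀ q xs ys → powerSum q (xs ++ ys) ≡ powerSum q xs + powerSum q ys
powerSum-++ q xs ys = trans (cong sum (map-++ (q ^_) xs ys)) (sum-++ (map (q ^_) xs) (map (q ^_) ys))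

powerSum-replicate-0 : ∀ q a → powerSum q (replicate a 0) ≡ a
powerSum-replicate-0 q zero = refl
powerSum-replicate-0 q (suc a) = cong suc (powerSum-replicate-0 q a)

powerSum-map-suc : ∀ q as → powerSum q (map suc as) ≡ q * powerSum q as
powerSum-map-suc q [] = sym (*-zeroʳ q)
powerSum-map-suc q (a ∷ as) = trans (cong (q * q ^ a +_) (powerSum-map-suc q as)) (sym (*-distribˡ-+ q (q ^ a) _))

exponentList : ∀ {n} → Vec ℕ n → List ℕ
exponentList [] = []
exponentList (a ∷ v) = replicate a 0 ++ map suc (exponentList v)

powerSum-exponentList : ∀ q {n} (v : Vec ℕ n) → powerSum q (exponentList v) ≡ eval q v
powerSum-exponentList q [] = refl
powerSum-exponentList q (a ∷ v) = begin
  powerSum q (replicate a 0 ++ map suc (exponentList v))             ≡⟨ powerSum-++ q (replicate a 0) _ ⟩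
  powerSum q (replicate a 0) + powerSum q (map suc (exponentList v)) ≡⟨ cong₂ _+_ (powerSum-replicate-0 q a) (powerSum-map-suc q (exponentList v)) ⟩
  a + q * powerSum q (exponentList v)                                ≡⟨ cong (λ x → a + q * x) (powerSum-exponentList q v) ⟩
  a + q * eval q v                                                   ∎
  where open ≡-Reasoning

length-exponentList : ∀ {n} (v : Vec ℕ n) → length (exponentList v) ≡ Vec.sum v
length-exponentList [] = refl
length-exponentList (a ∷ v) = begin
  length (replicate a 0 ++ map suc (exponentList v))             ≡⟨ length-++ (replicate a 0) ⟩
  length (replicate a 0) + length (map suc (exponentList v))     ≡⟨ cong₂ _+_ (length-replicate a) (length-map suc (exponentList v)) ⟩
  a + length (exponentList v)                                    ≡⟨ cong (a +_) (length-exponentList v) ⟩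
  a + Vec.sum v                                                  ∎
  where open ≡-Reasoning

incrementAt : ∀ {n} → ℕ → Vec ℕ n → Vec ℕ n
incrementAt _ [] = []
incrementAt zero (a ∷ v) = suc a ∷ v
incrementAt (suc i) (a ∷ v) = a ∷ incrementAt i v

eval-incrementAt : ∀ q {n} i (v : Vec ℕ n) → i < n → eval q (incrementAt i v) ≡ eval q v + q ^ i
eval-incrementAt q zero (a ∷ v) _ = sym (+-comm (a + q * eval q v) 1)
eval-incrementAt q (suc i) (a ∷ v) (s≤s i<n) = begin
  a + q * eval q (incrementAt i v) ≡⟨ cong (λ x → a + q * x) (eval-incrementAt q i v i<n) ⟩
  a + q * (eval q v + q ^ i)       ≡⟨ distrib a q (eval q v) (q ^ i) ⟩
  a + q * eval q v + q * q ^ i     ∎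
  where
  open ≡-Reasoning
  distrib : ∀ a q e y → a + q * (e + y) ≡ a + q * e + q * y
  distrib = solve-∀

sum-incrementAt : ∀ {n} i (v : Vec ℕ n) → i < n → Vec.sum (incrementAt i v) ≡ suc (Vec.sum v)
sum-incrementAt zero (a ∷ v) _ = refl
sum-incrementAt (suc i) (a ∷ v) (s≤s i<n) = trans (cong (a +_) (sum-incrementAt i v i<n)) (+-suc a (Vec.sum v))

exponentHistogram : List ℕ → Vec ℕ 7
exponentHistogram [] = Vec.replicate 7 0
exponentHistogram (a ∷ as) = incrementAt (a % 7) (exponentHistogram as)

sum-exponentHistogram : ∀ as → Vec.sum (exponentHistogram as) ≡ length as
sum-exponentHistogram [] = refl
sum-exponentHistogram (a ∷ as) = trans (sum-incrementAt (a % 7) (exponentHistogram as) (m%n<n a 7)) (cong suc (sum-exponentHistogram as))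

^≡^%7 : ∀ {q w} → q ^ 7 ≡ 1 + w → ∀ a → ∃[ x ] q ^ a ≡ q ^ (a % 7) + w * x
^≡^%7 {q} {w} q⁷≡1+w a = eval (suc w) (ones (a / 7)) * q ^ (a % 7) , (begin
  q ^ a                                      ≡⟨ cong (q ^_) (trans (m≡m%n+[m/n]*n a 7) (cong (a % 7 +_) (*-comm (a / 7) 7))) ⟩
  q ^ (a % 7 + 7 * (a / 7))                  ≡⟨ ^-distribˡ-+-* q (a % 7) (7 * (a / 7)) ⟩
  q ^ (a % 7) * q ^ (7 * (a / 7))            ≡⟨ cong (q ^ (a % 7) *_) (sym (^-*-assoc q 7 (a / 7))) ⟩
  q ^ (a % 7) * (q ^ 7) ^ (a / 7)            ≡⟨ cong (λ x → q ^ (a % 7) * x ^ (a / 7)) q⁷≡1+w ⟩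
  q ^ (a % 7) * suc w ^ (a / 7)              ≡⟨ cong (q ^ (a % 7) *_) ([1+d]^n≡1+d*eval-ones w (a / 7)) ⟩
  q ^ (a % 7) * (1 + w * E)                  ≡⟨ distrib (q ^ (a % 7)) w E ⟩
  q ^ (a % 7) + w * (E * q ^ (a % 7))        ∎)
  where
  open ≡-Reasoning
  E = eval (suc w) (ones (a / 7))
  distrib : ∀ x w e → x * (1 + w * e) ≡ x + w * (e * x)
  distrib = solve-∀

powerSum≡eval-exponentHistogram : ∀ {q w} → q ^ 7 ≡ 1 + w → ∀ as →
  ∃[ x ] powerSum q as ≡ eval q (exponentHistogram as) + w * x
powerSum≡eval-exponentHistogram {q} {w} _ [] = 0 , sym (trans (cong (_+ w * 0) (eval-replicate q 7 0)) (*-zeroʳ w))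
powerSum≡eval-exponentHistogram {q} {w} q⁷≡1+w (a ∷ as)
  with ^≡^%7 q⁷≡1+w a | powerSum≡eval-exponentHistogram q⁷≡1+w as
... | x , eₐ | y , eₛ = x + y , (begin
  q ^ a + powerSum q as                         ≡⟨ cong₂ _+_ eₐ eₛ ⟩
  q ^ (a % 7) + w * x + (E + w * y)             ≡⟨ regroup (q ^ (a % 7)) w x E y ⟩
  E + q ^ (a % 7) + w * (x + y)                 ≡⟨ cong (_+ w * (x + y)) (sym (eval-incrementAt q (a % 7) H (m%n<n a 7))) ⟩
  eval q (incrementAt (a % 7) H) + w * (x + y)  ∎)
  where
  open ≡-Reasoning
  H = exponentHistogram as
  E = eval q H
  regroup : ∀ z w x e y → z + w * x + (e + w * y) ≡ e + z + w * (x + y)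
  regroup = solve-∀

∣powerSum⇒∣eval-exponentHistogram : ∀ {q w N} → q ^ 7 ≡ 1 + w → N ∣ w → ∀ as →
  N ∣ powerSum q as → N ∣ eval q (exponentHistogram as)
∣powerSum⇒∣eval-exponentHistogram {q} {w} {N} q⁷≡1+w N∣w as N∣Σ =
  let x , e = powerSum≡eval-exponentHistogram q⁷≡1+w as
  in ∣m+n∣m⇒∣n (subst (N ∣_) (trans e (+-comm _ (w * x))) N∣Σ) (∣m⇒∣m*n x N∣w)

module _ {N : ℕ} .{{_ : NonZero N}} where

  %-cong-+ : ∀ {m m′ n n′} → m % N ≡ m′ % N → n % N ≡ n′ % N → (m + n) % N ≡ (m′ + n′) % N
  %-cong-+ {m} {m′} {n} {n′} m≡m′ n≡n′ = begin
    (m + n) % N             ≡⟨ %-distribˡ-+ m n N ⟩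
    (m % N + n % N) % N     ≡⟨ cong₂ (λ x y → (x + y) % N) m≡m′ n≡n′ ⟩
    (m′ % N + n′ % N) % N   ≡⟨ %-distribˡ-+ m′ n′ N ⟨
    (m′ + n′) % N           ∎
    where open ≡-Reasoning

  %-cong-* : ∀ {m m′ n n′} → m % N ≡ m′ % N → n % N ≡ n′ % N → (m * n) % N ≡ (m′ * n′) % N
  %-cong-* {m} {m′} {n} {n′} m≡m′ n≡n′ = begin
    (m * n) % N             ≡⟨ %-distribˡ-* m n N ⟩
    (m % N * (n % N)) % N   ≡⟨ cong₂ (λ x y → (x * y) % N) m≡m′ n≡n′ ⟩
    (m′ % N * (n′ % N)) % N ≡⟨ %-distribˡ-* m′ n′ N ⟨
    (m′ * n′) % N           ∎
    where open ≡-Reasoning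

  ^-% : ∀ q n → q ^ n % N ≡ (q % N) ^ n % N
  ^-% q zero = refl
  ^-% q (suc n) = %-cong-* (sym (m%n%n≡m%n q N)) (^-% q n)

  eval-% : ∀ q {n} (v : Vec ℕ n) → eval q v % N ≡ eval (q % N) v % N
  eval-% q [] = refl
  eval-% q (a ∷ v) = %-cong-+ {a} refl (%-cong-* (sym (m%n%n≡m%n q N)) (eval-% q v))

  ∣eval⇔∣eval-% : ∀ q {n} (v : Vec ℕ n) → N ∣ eval q v ⇔ N ∣ eval (q % N) v
  ∣eval⇔∣eval-% q v = mk⇔
    (λ N∣ → m%n≡0⇒n∣m _ N (trans (sym (eval-% q v)) (n∣m⇒m%n≡0 _ N N∣)))
    (λ N∣ → m%n≡0⇒n∣m _ N (trans (eval-% q v) (n∣m⇒m%n≡0 _ N N∣)))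

  [1+m]%N≡1 : ∀ {m} → 1 < N → N ∣ m → (1 + m) % N ≡ 1
  [1+m]%N≡1 {m} 1<N N∣m = trans (%-remove-+ʳ 1 N∣m) (m<n⇒m%n≡m 1<N)

  [1+d]%N≡1⇒∣ : ∀ {d} → suc d % N ≡ 1 → N ∣ d
  [1+d]%N≡1⇒∣ {d} e = divides (suc d / N) (suc-injective (begin
    suc d                      ≡⟨ m≡m%n+[m/n]*n (suc d) N ⟩
    suc d % N + suc d / N * N  ≡⟨ cong (_+ suc d / N * N) e ⟩
    suc (suc d / N * N)        ∎))
    where open ≡-Reasoning

∣prime⇒≡ : ∀ {p r} → Prime r → Prime p → p ∣ r → p ≡ r
∣prime⇒≡ prime-r prime-p p∣r with prime⇒irreducible prime-r p∣r
... | inj₁ refl = contradiction prime-p ¬prime[1]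
... | inj₂ p≡r = p≡r

m∣m^n : ∀ {m n} → 0 < n → m ∣ m ^ n
m∣m^n {m} {suc n} _ = m∣m*n (m ^ n)

^-mono-∣ : ∀ r {i j} → i ≤ j → r ^ i ∣ r ^ j
^-mono-∣ r {i} {j} i≤j = divides (r ^ (j ∸ i)) (begin
  r ^ j                 ≡⟨ cong (r ^_) (m+[n∸m]≡n i≤j) ⟨
  r ^ (i + (j ∸ i))     ≡⟨ ^-distribˡ-+-* r i (j ∸ i) ⟩
  r ^ i * r ^ (j ∸ i)   ≡⟨ *-comm (r ^ i) _ ⟩
  r ^ (j ∸ i) * r ^ i   ∎)
  where open ≡-Reasoning

p^k∣m*n⇒p^k∣m : ∀ {p} k {m n} → Prime p → ¬ p ∣ n → p ^ k ∣ m * n → p ^ k ∣ m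
p^k∣m*n⇒p^k∣m zero _ _ _ = 1∣ _
p^k∣m*n⇒p^k∣m {p} (suc k) {m} {n} prime-p p∤n pᵏ⁺¹∣mn with euclidsLemma m n prime-p (∣-trans (m∣m*n (p ^ k)) pᵏ⁺¹∣mn)
... | inj₂ p∣n = contradiction p∣n p∤n
... | inj₁ (divides m′ refl) = subst (p * p ^ k ∣_) (*-comm p m′) (*-monoʳ-∣ p (p^k∣m*n⇒p^k∣m k prime-p p∤n pᵏ∣m′n))
  where
  reassoc : ∀ x p y → x * p * y ≡ p * (x * y)
  reassoc = solve-∀
  pᵏ∣m′n : p ^ k ∣ m′ * n
  pᵏ∣m′n = *-cancelˡ-∣ p {{prime⇒nonZero prime-p}} (subst (p * p ^ k ∣_) (reassoc m′ p n) pᵏ⁺¹∣mn)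

7∣p∸1⇒p%7≡1 : ∀ {p} → 0 < p → 7 ∣ p ∸ 1 → p % 7 ≡ 1
7∣p∸1⇒p%7≡1 {suc _} _ (divides j refl) = [m+kn]%n≡m%n 1 j 7

7∣p∸1⇒7<p : ∀ {p} → Prime p → 7 ∣ p ∸ 1 → 7 < p
7∣p∸1⇒7<p {zero} prime-p _ = contradiction prime-p ¬prime[0]
7∣p∸1⇒7<p {suc _} prime-p (divides zero refl) = contradiction prime-p ¬prime[1]
7∣p∸1⇒7<p {suc _} _ (divides (suc j) refl) = s≤s (m≤m+n 7 (j * 7))

-- Multiplication in ℕ[x]/(x⁷ − 1)

_⊛_ : Vec ℕ 7 → Vec ℕ 7 → Vec ℕ 7
(a₀ ∷ a₁ ∷ a₂ ∷ a₃ ∷ a₄ ∷ a₅ ∷ a₆ ∷ []) ⊛ (b₀ ∷ b₁ ∷ b₂ ∷ b₃ ∷ b₄ ∷ b₅ ∷ b₆ ∷ []) =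
  (a₀ * b₀ + (a₁ * b₆ + a₂ * b₅ + a₃ * b₄ + a₄ * b₃ + a₅ * b₂ + a₆ * b₁)) ∷
  (a₀ * b₁ + a₁ * b₀ + (a₂ * b₆ + a₃ * b₅ + a₄ * b₄ + a₅ * b₃ + a₆ * b₂)) ∷
  (a₀ * b₂ + a₁ * b₁ + a₂ * b₀ + (a₃ * b₆ + a₄ * b₅ + a₅ * b₄ + a₆ * b₃)) ∷
  (a₀ * b₃ + a₁ * b₂ + a₂ * b₁ + a₃ * b₀ + (a₄ * b₆ + a₅ * b₅ + a₆ * b₄)) ∷
  (a₀ * b₄ + a₁ * b₃ + a₂ * b₂ + a₃ * b₁ + a₄ * b₀ + (a₅ * b₆ + a₆ * b₅)) ∷
  (a₀ * b₅ + a₁ * b₄ + a₂ * b₃ + a₃ * b₂ + a₄ * b₁ + a₅ * b₀ + a₆ * b₆) ∷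
  (a₀ * b₆ + a₁ * b₅ + a₂ * b₄ + a₃ * b₃ + a₄ * b₂ + a₅ * b₁ + a₆ * b₀) ∷ []

-- The coefficients of x⁷, …, x¹² in the ordinary product, which ⊛ folds back onto x⁰, …, x⁵.
overflow : Vec ℕ 7 → Vec ℕ 7 → Vec ℕ 6
overflow (a₀ ∷ a₁ ∷ a₂ ∷ a₃ ∷ a₄ ∷ a₅ ∷ a₆ ∷ []) (b₀ ∷ b₁ ∷ b₂ ∷ b₃ ∷ b₄ ∷ b₅ ∷ b₆ ∷ []) =
  (a₁ * b₆ + a₂ * b₅ + a₃ * b₄ + a₄ * b₃ + a₅ * b₂ + a₆ * b₁) ∷
  (a₂ * b₆ + a₃ * b₅ + a₄ * b₄ + a₅ * b₃ + a₆ * b₂) ∷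
  (a₃ * b₆ + a₄ * b₅ + a₅ * b₄ + a₆ * b₃) ∷
  (a₄ * b₆ + a₅ * b₅ + a₆ * b₄) ∷
  (a₅ * b₆ + a₆ * b₅) ∷
  (a₆ * b₆) ∷ []

eval-⊛ : ∀ {q w} → q ^ 7 ≡ 1 + w → ∀ u c →
  eval q u * eval q c ≡ eval q (u ⊛ c) + eval q (overflow u c) * w
eval-⊛ {q} {w} q⁷≡1+w u c = +-cancelʳ-≡ (eval q (overflow u c)) _ _ (begin
  eval q u * eval q c + O                  ≡⟨ product u c ⟩
  eval q (u ⊛ c) + O * q ^ 7               ≡⟨ cong (λ x → eval q (u ⊛ c) + O * x) q⁷≡1+w ⟩
  eval q (u ⊛ c) + O * (1 + w)             ≡⟨ distrib (eval q (u ⊛ c)) O w ⟩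
  eval q (u ⊛ c) + O * w + O               ∎)
  where
  open ≡-Reasoning
  O = eval q (overflow u c)
  distrib : ∀ g o w → g + o * (1 + w) ≡ g + o * w + o
  distrib = solve-∀
  product : ∀ u c → eval q u * eval q c + eval q (overflow u c) ≡ eval q (u ⊛ c) + eval q (overflow u c) * q ^ 7
  product (a₀ ∷ a₁ ∷ a₂ ∷ a₃ ∷ a₄ ∷ a₅ ∷ a₆ ∷ []) (b₀ ∷ b₁ ∷ b₂ ∷ b₃ ∷ b₄ ∷ b₅ ∷ b₆ ∷ []) =
    identity q a₀ a₁ a₂ a₃ a₄ a₅ a₆ b₀ b₁ b₂ b₃ b₄ b₅ b₆
    where
    identity : ∀ q a₀ a₁ a₂ a₃ a₄ a₅ a₆ b₀ b₁ b₂ b₃ b₄ b₅ b₆ →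
      (a₀ + q * (a₁ + q * (a₂ + q * (a₃ + q * (a₄ + q * (a₅ + q * (a₆ + q * 0)))))))
      * (b₀ + q * (b₁ + q * (b₂ + q * (b₃ + q * (b₄ + q * (b₅ + q * (b₆ + q * 0)))))))
      + ((a₁ * b₆ + a₂ * b₅ + a₃ * b₄ + a₄ * b₃ + a₅ * b₂ + a₆ * b₁) + q * ((a₂ * b₆ + a₃ * b₅ + a₄ * b₄ + a₅ * b₃ + a₆ * b₂)
        + q * ((a₃ * b₆ + a₄ * b₅ + a₅ * b₄ + a₆ * b₃) + q * ((a₄ * b₆ + a₅ * b₅ + a₆ * b₄) + q * ((a₅ * b₆ + a₆ * b₅) + q * (a₆ * b₆ + q * 0))))))
      ≡
      ((a₀ * b₀ + (a₁ * b₆ + a₂ * b₅ + a₃ * b₄ + a₄ * b₃ + a₅ * b₂ + a₆ * b₁)) + q * (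
      (a₀ * b₁ + a₁ * b₀ + (a₂ * b₆ + a₃ * b₅ + a₄ * b₄ + a₅ * b₃ + a₆ * b₂)) + q * (
      (a₀ * b₂ + a₁ * b₁ + a₂ * b₀ + (a₃ * b₆ + a₄ * b₅ + a₅ * b₄ + a₆ * b₃)) + q * (
      (a₀ * b₃ + a₁ * b₂ + a₂ * b₁ + a₃ * b₀ + (a₄ * b₆ + a₅ * b₅ + a₆ * b₄)) + q * (
      (a₀ * b₄ + a₁ * b₃ + a₂ * b₂ + a₃ * b₁ + a₄ * b₀ + (a₅ * b₆ + a₆ * b₅)) + q * (
      (a₀ * b₅ + a₁ * b₄ + a₂ * b₃ + a₃ * b₂ + a₄ * b₁ + a₅ * b₀ + a₆ * b₆) + q * (
      (a₀ * b₆ + a₁ * b₅ + a₂ * b₄ + a₃ * b₃ + a₄ * b₂ + a₅ * b₁ + a₆ * b₀) + q * 0)))))))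
      + ((a₁ * b₆ + a₂ * b₅ + a₃ * b₄ + a₄ * b₃ + a₅ * b₂ + a₆ * b₁) + q * ((a₂ * b₆ + a₃ * b₅ + a₄ * b₄ + a₅ * b₃ + a₆ * b₂)
        + q * ((a₃ * b₆ + a₄ * b₅ + a₅ * b₄ + a₆ * b₃) + q * ((a₄ * b₆ + a₅ * b₅ + a₆ * b₄) + q * ((a₅ * b₆ + a₆ * b₅) + q * (a₆ * b₆ + q * 0))))))
        * (q * (q * (q * (q * (q * (q * (q * 1)))))))
    identity = solve-∀

-- σⱼ c is c(xʲ) reduced modulo x⁷ − 1.
σ₂ σ₃ σ₄ σ₅ σ₆ : Vec ℕ 7 → Vec ℕ 7
σ₂ (c₀ ∷ c₁ ∷ c₂ ∷ c₃ ∷ c₄ ∷ c₅ ∷ c₆ ∷ []) = c₀ ∷ c₄ ∷ c₁ ∷ c₅ ∷ c₂ ∷ c₆ ∷ c₃ ∷ []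
σ₃ (c₀ ∷ c₁ ∷ c₂ ∷ c₃ ∷ c₄ ∷ c₅ ∷ c₆ ∷ []) = c₀ ∷ c₅ ∷ c₃ ∷ c₁ ∷ c₆ ∷ c₄ ∷ c₂ ∷ []
σ₄ (c₀ ∷ c₁ ∷ c₂ ∷ c₃ ∷ c₄ ∷ c₅ ∷ c₆ ∷ []) = c₀ ∷ c₂ ∷ c₄ ∷ c₆ ∷ c₁ ∷ c₃ ∷ c₅ ∷ []
σ₅ (c₀ ∷ c₁ ∷ c₂ ∷ c₃ ∷ c₄ ∷ c₅ ∷ c₆ ∷ []) = c₀ ∷ c₃ ∷ c₆ ∷ c₂ ∷ c₅ ∷ c₁ ∷ c₄ ∷ []
σ₆ (c₀ ∷ c₁ ∷ c₂ ∷ c₃ ∷ c₄ ∷ c₅ ∷ c₆ ∷ []) = c₀ ∷ c₆ ∷ c₅ ∷ c₄ ∷ c₃ ∷ c₂ ∷ c₁ ∷ []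

conjugates : Vec ℕ 7 → Vec ℕ 7
conjugates c = σ₂ c ⊛ (σ₃ c ⊛ (σ₄ c ⊛ (σ₅ c ⊛ σ₆ c)))

norm : Vec ℕ 7 → Vec ℕ 7
norm c = conjugates c ⊛ c

scalarPlusOnes : ℕ → ℕ → Vec ℕ 7
scalarPlusOnes r m = (r + m) ∷ Vec.replicate 6 m

eval-scalarPlusOnes : ∀ q r m → eval q (scalarPlusOnes r m) ≡ r + m * Φ₇ q
eval-scalarPlusOnes q r m = begin
  r + m + q * eval q (Vec.replicate 6 m) ≡⟨ cong (λ x → r + m + q * x) (eval-replicate q 6 m) ⟩
  r + m + q * (m * eval q (ones 6))     ≡⟨ distrib r m q (eval q (ones 6)) ⟩
  r + m * (1 + q * eval q (ones 6))     ∎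
  where
  open ≡-Reasoning
  distrib : ∀ r m q e → r + m + q * (m * e) ≡ r + m * (1 + q * e)
  distrib = solve-∀

∣eval⇒∣scalar : ∀ {q w N u c r m} → q ^ 7 ≡ 1 + w → N ∣ w → N ∣ Φ₇ q → N ∣ eval q c →
  u ⊛ c ≡ scalarPlusOnes r m → N ∣ r
∣eval⇒∣scalar {q} {w} {N} {u} {c} {r} {m} q⁷≡1+w N∣w N∣Φ N∣c u⊛c≡ =
  ∣m+n∣m⇒∣n (subst (N ∣_) uc≡ (∣n⇒∣m*n (eval q u) N∣c))
            (∣m∣n⇒∣m+n (∣n⇒∣m*n m N∣Φ) (∣n⇒∣m*n (eval q (overflow u c)) N∣w))
  where
  open ≡-Reasoning
  O = eval q (overflow u c)
  uc≡ : eval q u * eval q c ≡ m * Φ₇ q + O * w + r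
  uc≡ = begin
    eval q u * eval q c                       ≡⟨ eval-⊛ q⁷≡1+w u c ⟩
    eval q (u ⊛ c) + O * w                    ≡⟨ cong (λ g → eval q g + O * w) u⊛c≡ ⟩
    eval q (scalarPlusOnes r m) + O * w       ≡⟨ cong (_+ O * w) (eval-scalarPlusOnes q r m) ⟩
    r + m * Φ₇ q + O * w                      ≡⟨ +-assoc r _ _ ⟩
    r + (m * Φ₇ q + O * w)                    ≡⟨ +-comm r _ ⟩
    m * Φ₇ q + O * w + r                      ∎

all-sound : ∀ {A : Set} {P : A → Bool} {xs x} → T (all P xs) → x ∈ xs → T (P x)
all-sound {P = P} {xs} h = All.lookup (all⁺ P xs h)

allCompositions : (n t : ℕ) → (Vec ℕ n → Bool) → Bool
allCompositions zero zero P = P []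
allCompositions zero (suc t) P = true
allCompositions (suc n) t P = all (λ a → allCompositions n (t ∸ a) (P ∘ (a ∷_))) (upTo (suc t))

allCompositions-sound : ∀ {n t P} → T (allCompositions n t P) → ∀ (v : Vec ℕ n) → Vec.sum v ≡ t → T (P v)
allCompositions-sound {zero} {zero} h [] refl = h
allCompositions-sound {suc n} {_} {P} h (a ∷ v) refl =
  allCompositions-sound {n} {P = P ∘ (a ∷_)} (subst (λ s → T (allCompositions n s (P ∘ (a ∷_)))) (m+n∸m≡n a (Vec.sum v)) h′) v refl
  where h′ = all-sound h (∈-upTo⁺ (s≤s (m≤m+n a (Vec.sum v))))

anyComposition : (n t : ℕ) → (Vec ℕ n → Bool) → Bool
anyComposition zero zero P = P []
anyComposition zero (suc t) P = false
anyComposition (suc n) t P = any (λ a → anyComposition n (t ∸ a) (P ∘ (a ∷_))) (upTo (suc t))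

anyComposition-sound : ∀ {n t P} → T (anyComposition n t P) → ∃[ v ] (Vec.sum v ≡ t × T (P v))
anyComposition-sound {zero} {zero} h = [] , refl , h
anyComposition-sound {suc n} {t} {P} h with find (any⁻ _ (upTo (suc t)) h)
... | a , a∈ , h′ with anyComposition-sound {n} {t ∸ a} {P ∘ (a ∷_)} h′
...   | v , Σv≡ , Pv = a ∷ v , trans (cong (a +_) Σv≡) (m+[n∸m]≡n (s≤s⁻¹ (∈-upTo⁻ a∈))) , Pv

allNontrivialSeventhRoots : (N : ℕ) .{{_ : NonZero N}} → (ℕ → Bool) → Bool
allNontrivialSeventhRoots N P = all (λ r → ⌊ r ≟ 1 ⌋ ∨ not ⌊ r ^ 7 % N ≟ 1 ⌋ ∨ P r) (upTo N)

allNontrivialSeventhRoots-sound : ∀ {N} .{{_ : NonZero N}} {P q} → T (allNontrivialSeventhRoots N P) →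
  q ^ 7 % N ≡ 1 → q % N ≢ 1 → T (P (q % N))
allNontrivialSeventhRoots-sound {N} {P} {q} h q⁷≡1 q≢1
  with T-∨ {⌊ q % N ≟ 1 ⌋} .to (all-sound {P = λ r → ⌊ r ≟ 1 ⌋ ∨ not ⌊ r ^ 7 % N ≟ 1 ⌋ ∨ P r} h (∈-upTo⁺ (m%n<n q N)))
... | inj₁ r≡1 = contradiction (toWitness r≡1) q≢1
... | inj₂ h′ with T-∨ {not ⌊ (q % N) ^ 7 % N ≟ 1 ⌋} .to h′
...   | inj₁ r⁷≢1 = contradiction (trans (sym (^-% q 7)) q⁷≡1) (toWitnessFalse r⁷≢1)
...   | inj₂ Pr = Pr

-- Matching on R before testing divisibility keeps the normal form of `removeFactors rs R` small
-- for a variable R; testing first makes it grow exponentially in the length of rs.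
removeFactor : (fuel r R : ℕ) → ℕ
removeFactor zero _ R = R
removeFactor (suc f) _ zero = zero
removeFactor (suc f) zero R = R
removeFactor (suc f) (suc r) R@(suc _) = if R % suc r ≡ᵇ 0 then removeFactor f (suc r) (R / suc r) else R

removeFactor-complete : ∀ f {r R p} → Prime r → Prime p → p ∣ R → p ≡ r ⊎ p ∣ removeFactor f r R
removeFactor-complete zero _ _ p∣R = inj₂ p∣R
removeFactor-complete (suc f) {R = zero} _ _ p∣R = inj₂ p∣R
removeFactor-complete (suc f) {zero} {suc _} _ _ p∣R = inj₂ p∣R
removeFactor-complete (suc f) {suc r} {R@(suc _)} {p} prime-r prime-p p∣R with R % suc r ≡ᵇ 0 in r∣R
... | false = inj₂ p∣R
... | true with euclidsLemma (R / suc r) (suc r) prime-p (subst (p ∣_) R≡ p∣R)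
  where
  R≡ : R ≡ R / suc r * suc r
  R≡ = sym (m/n*n≡m (m%n≡0⇒n∣m R (suc r) (≡ᵇ⇒≡ _ 0 (subst T (sym r∣R) _))))
...   | inj₁ p∣R/r = removeFactor-complete f prime-r prime-p p∣R/r
...   | inj₂ p∣r = inj₁ (∣prime⇒≡ prime-r prime-p p∣r)

removeFactors : List ℕ → ℕ → ℕ
removeFactors [] R = R
removeFactors (r ∷ rs) R = removeFactors rs (removeFactor 40 r R)

removeFactors-complete : ∀ {rs R p} → All Prime rs → Prime p → p ∣ R → p ∈ rs ⊎ p ∣ removeFactors rs R
removeFactors-complete All.[] _ p∣R = inj₂ p∣R
removeFactors-complete {r ∷ rs} (prime-r All.∷ primes) prime-p p∣R with removeFactor-complete 40 prime-r prime-p p∣R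
... | inj₁ refl = inj₁ (here refl)
... | inj₂ p∣R′ with removeFactors-complete primes prime-p p∣R′
...   | inj₁ p∈rs = inj₁ (there p∈rs)
...   | inj₂ p∣R″ = inj₂ p∣R″

removeFactors≡1⇒∈ : ∀ {rs R p} → All Prime rs → removeFactors rs R ≡ 1 → Prime p → p ∣ R → p ∈ rs
removeFactors≡1⇒∈ primes removed≡1 prime-p p∣R with removeFactors-complete primes prime-p p∣R
... | inj₁ p∈rs = p∈rs
... | inj₂ p∣1 = contradiction (subst Prime (∣1⇒≡1 (subst (_ ∣_) removed≡1 p∣1)) prime-p) ¬prime[1]

exceptionalClasses : List (List ℕ)
exceptionalClasses =
  (43 ∷ []) ∷ (29 ∷ 71 ∷ 547 ∷ []) ∷ (113 ∷ 197 ∷ 421 ∷ 463 ∷ []) ∷ (211 ∷ 379 ∷ 449 ∷ 757 ∷ 2689 ∷ []) ∷ []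

inList⇒∈ : ∀ {x L} → T (inList x L) → x ∈ L
inList⇒∈ {x} {y ∷ L} h with T-∨ .to h
... | inj₁ x≡y = here (≡ᵇ⇒≡ x y x≡y)
... | inj₂ x∈L = there (inList⇒∈ x∈L)

inExceptionalClass : ∀ {p k} L → L ∈ exceptionalClasses → (k ≡ᵇ 1) ∧ inList p L ≡ true →
  k ≡ 1 × ∃[ L ] (L ∈ exceptionalClasses × p ∈ L)
inExceptionalClass {p} {k} L L∈ h with T-∧ {k ≡ᵇ 1} .to (T-≡ .from h)
... | k≡1 , p∈L = ≡ᵇ⇒≡ k 1 k≡1 , L , L∈ , inList⇒∈ p∈L

expectedM-cases : ∀ p k → expectedM p k ≡ 7 ⊎ (k ≡ 1 × ∃[ L ] (L ∈ exceptionalClasses × p ∈ L))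
expectedM-cases p k with (k ≡ᵇ 1) ∧ inList p (43 ∷ []) in e
... | true = inj₂ (inExceptionalClass _ (here refl) e)
... | false with (k ≡ᵇ 1) ∧ inList p (29 ∷ 71 ∷ 547 ∷ []) in e
...   | true = inj₂ (inExceptionalClass _ (there (here refl)) e)
...   | false with (k ≡ᵇ 1) ∧ inList p (113 ∷ 197 ∷ 421 ∷ 463 ∷ []) in e
...     | true = inj₂ (inExceptionalClass _ (there (there (here refl))) e)
...     | false with (k ≡ᵇ 1) ∧ inList p (211 ∷ 379 ∷ 449 ∷ 757 ∷ 2689 ∷ []) in e
...       | true = inj₂ (inExceptionalClass _ (there (there (there (here refl)))) e)
...       | false = inj₁ refl

expectedM-pres : ∀ (P : ℕ → Set) → P 3 → P 4 → P 5 → P 6 → P 7 → ∀ p k → P (expectedM p k)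
expectedM-pres P P3 P4 P5 P6 P7 p k with (k ≡ᵇ 1) ∧ inList p (43 ∷ [])
... | true = P3
... | false with (k ≡ᵇ 1) ∧ inList p (29 ∷ 71 ∷ 547 ∷ [])
...   | true = P4
...   | false with (k ≡ᵇ 1) ∧ inList p (113 ∷ 197 ∷ 421 ∷ 463 ∷ [])
...     | true = P5
...     | false with (k ≡ᵇ 1) ∧ inList p (211 ∷ 379 ∷ 449 ∷ 757 ∷ 2689 ∷ [])
...       | true = P6
...       | false = P7

expectedM≤7 : ∀ p k → expectedM p k ≤ 7
expectedM≤7 = expectedM-pres (_≤ 7) (≤ᵇ⇒≤ 3 7 _) (≤ᵇ⇒≤ 4 7 _) (≤ᵇ⇒≤ 5 7 _) (≤ᵇ⇒≤ 6 7 _) ≤-refl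

expectedM>0 : ∀ p k → 0 < expectedM p k
expectedM>0 = expectedM-pres (0 <_) z<s z<s z<s z<s z<s

-- In the case (29, 2) the norm does not suffice; it is settled by `noShortZeroSums-29²` below.
admissible : ℕ → ℕ → ℕ → Bool
admissible t r j = (expectedM r j ≤ᵇ t) ∨ ((r ≡ᵇ 29) ∧ (j ≡ᵇ 2))

admissible-sound : ∀ {t r j} → T (admissible t r j) → expectedM r j ≤ t ⊎ (r ≡ 29 × j ≡ 2)
admissible-sound {t} {r} {j} h with T-∨ .to h
... | inj₁ m≤t = inj₁ (≤ᵇ⇒≤ _ t m≤t)
... | inj₂ r,j with T-∧ .to r,j
...   | r≡29 , j≡2 = inj₂ (≡ᵇ⇒≡ r 29 r≡29 , ≡ᵇ⇒≡ j 2 j≡2)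

-- Fails when the fuel runs out before the powers of r stop dividing R.
powersAdmissible : (fuel t r R i : ℕ) → Bool
powersAdmissible zero t r R i = false
powersAdmissible (suc f) t r R i =
  if ⌊ r ^ i ∣? R ⌋ then admissible t r i ∧ powersAdmissible f t r R (suc i) else true

powersAdmissible-sound : ∀ f {t r R i j} → T (powersAdmissible f t r R i) → i ≤ j → r ^ j ∣ R → T (admissible t r j)
powersAdmissible-sound (suc f) {t} {r} {R} {i} {j} h i≤j rʲ∣R with r ^ i ∣? R
... | no rⁱ∤R = contradiction (∣-trans (^-mono-∣ r i≤j) rʲ∣R) rⁱ∤R
... | yes _ with m≤n⇒m<n∨m≡n i≤j
...   | inj₂ refl = T-∧ .to h .proj₁
...   | inj₁ i<j = powersAdmissible-sound f (T-∧ .to h .proj₂) i<j rʲ∣R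

smallPrimes : List ℕ
smallPrimes = 2 ∷ 3 ∷ 5 ∷ 13 ∷ 29 ∷ 41 ∷ 43 ∷ 71 ∷ 113 ∷ 197 ∷ 211 ∷ 379 ∷ 421 ∷ 449 ∷ 463 ∷ 547 ∷ 757 ∷ 2689 ∷ []

smallPrimes-prime : All Prime smallPrimes
smallPrimes-prime = from-yes (All.all? prime? smallPrimes)

primePowersAdmissible : ℕ → ℕ → Bool
primePowersAdmissible t R = all (λ r → not ⌊ r % 7 ≟ 1 ⌋ ∨ powersAdmissible 20 t r R 1) smallPrimes

factorCertificate-sound : ∀ {t R p k} → Prime p → p % 7 ≡ 1 → 0 < k → p ^ k ∣ R →
  removeFactors smallPrimes R ≡ 1 → T (primePowersAdmissible t R) → expectedM p k ≤ t ⊎ (p ≡ 29 × k ≡ 2)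
factorCertificate-sound {t} {R} {p} {suc k} prime-p p%7≡1 _ pᵏ∣R smooth powers =
  conclude (T-∨ .to (all-sound {P = λ r → not ⌊ r % 7 ≟ 1 ⌋ ∨ powersAdmissible 20 t r R 1} powers p∈smallPrimes))
  where
  p∈smallPrimes : p ∈ smallPrimes
  p∈smallPrimes = removeFactors≡1⇒∈ smallPrimes-prime smooth prime-p (∣-trans (m∣m*n (p ^ k)) pᵏ∣R)
  conclude : T (not ⌊ p % 7 ≟ 1 ⌋) ⊎ T (powersAdmissible 20 t p R 1) → expectedM p (suc k) ≤ t ⊎ (p ≡ 29 × suc k ≡ 2)
  conclude (inj₁ p%7≢1) = contradiction p%7≡1 (toWitnessFalse p%7≢1)
  conclude (inj₂ bounded) = admissible-sound {t} {p} (powersAdmissible-sound 20 {t} {p} {R} {1} {suc k} bounded (s≤s z≤n) pᵏ∣R)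

normCertificate : ℕ → Vec ℕ 7 → Bool
normCertificate t c with norm c
... | g@(g₀ ∷ g₁ ∷ _) = ⌊ Vec.≡-dec _≟_ g (scalarPlusOnes (g₀ ∸ g₁) g₁) ⌋
                        ∧ (⌊ removeFactors smallPrimes (g₀ ∸ g₁) ≟ 1 ⌋ ∧ primePowersAdmissible t (g₀ ∸ g₁))

normCertificate-sound : ∀ {t p k} c → Prime p → p % 7 ≡ 1 → 0 < k →
  (∀ {r m} → norm c ≡ scalarPlusOnes r m → p ^ k ∣ r) → T (normCertificate t c) → expectedM p k ≤ t ⊎ (p ≡ 29 × k ≡ 2)
normCertificate-sound c prime-p p%7≡1 k>0 ∣r h with norm c
... | g@(g₀ ∷ g₁ ∷ _) =
  let shape , rest = T-∧ {⌊ Vec.≡-dec _≟_ g (scalarPlusOnes (g₀ ∸ g₁) g₁) ⌋} .to h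
      smooth , powers = T-∧ {⌊ removeFactors smallPrimes (g₀ ∸ g₁) ≟ 1 ⌋} .to rest
  in factorCertificate-sound prime-p p%7≡1 k>0 (∣r (toWitness shape)) (toWitness smooth) powers

zeroSumOfWeight : (m p r : ℕ) → Bool
zeroSumOfWeight m p r = anyComposition 7 m (λ c → ⌊ p ∣? eval r c ⌋)

noZeroSumOfWeight≤6 : (N r : ℕ) → Bool
noZeroSumOfWeight≤6 N r = all (λ t → allCompositions 7 (suc t) (λ c → not ⌊ N ∣? eval r c ⌋)) (upTo 6)

zeroSumWitnesses : ℕ → Bool
zeroSumWitnesses zero = false
zeroSumWitnesses p@(suc _) = allNontrivialSeventhRoots p (zeroSumOfWeight (expectedM p 1) p)

zeroSumWitnesses-sound : ∀ {p q} .{{_ : NonZero p}} → T (zeroSumWitnesses p) →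
  q ^ 7 % p ≡ 1 → q % p ≢ 1 → HasZeroSumOfPowers q p (expectedM p 1)
zeroSumWitnesses-sound {p@(suc _)} {q} h q⁷≡1 q≢1 = witness (anyComposition-sound {7} {expectedM p 1} found)
  where
  found : T (zeroSumOfWeight (expectedM p 1) p (q % p))
  found = allNontrivialSeventhRoots-sound {p} {P = zeroSumOfWeight (expectedM p 1) p} {q} h q⁷≡1 q≢1
  witness : ∃[ c ] (Vec.sum c ≡ expectedM p 1 × T ⌊ p ∣? eval (q % p) c ⌋) → HasZeroSumOfPowers q p (expectedM p 1)
  witness (c , Σc≡ , p∣c) = exponentList c , trans (length-exponentList c) Σc≡ ,
    subst (p ∣_) (sym (powerSum-exponentList q c)) (∣eval⇔∣eval-% q c .from (toWitness p∣c))

noZeroSumOfWeight≤6-sound : ∀ {N q} .{{_ : NonZero N}} → T (allNontrivialSeventhRoots N (noZeroSumOfWeight≤6 N)) →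
  q ^ 7 % N ≡ 1 → q % N ≢ 1 → ∀ c {t} → 0 < t → t ≤ 6 → Vec.sum c ≡ t → ¬ N ∣ eval q c
noZeroSumOfWeight≤6-sound {N} {q} h q⁷≡1 q≢1 c {suc t} _ t<6 Σc≡ N∣c = toWitnessFalse noZeroSum (∣eval⇔∣eval-% q c .to N∣c)
  where
  none : T (noZeroSumOfWeight≤6 N (q % N))
  none = allNontrivialSeventhRoots-sound {N} {P = noZeroSumOfWeight≤6 N} {q} h q⁷≡1 q≢1
  noZeroSum : T (not ⌊ N ∣? eval (q % N) c ⌋)
  noZeroSum = allCompositions-sound {7} {suc t} {λ c → not ⌊ N ∣? eval (q % N) c ⌋}
    (all-sound {P = λ t → allCompositions 7 (suc t) (λ c → not ⌊ N ∣? eval (q % N) c ⌋)} none (∈-upTo⁺ t<6)) c Σc≡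

normCertificates : ∀ {t} → 0 < t → t ≤ 6 → T (allCompositions 7 t (normCertificate t))
normCertificates {1} _ _ = _
normCertificates {2} _ _ = _
normCertificates {3} _ _ = _
normCertificates {4} _ _ = _
normCertificates {5} _ _ = _
normCertificates {6} _ _ = _
normCertificates {suc (suc (suc (suc (suc (suc (suc _))))))} _ (s≤s (s≤s (s≤s (s≤s (s≤s (s≤s ()))))))

exceptionalWitnesses : T (all (all zeroSumWitnesses) exceptionalClasses)
exceptionalWitnesses = _

noShortZeroSums-29² : T (allNontrivialSeventhRoots 841 (noZeroSumOfWeight≤6 841))
noShortZeroSums-29² = _

module Order7 {p k d} (prime-p : Prime p) (7∣p∸1 : 7 ∣ p ∸ 1) (k>0 : 0 < k) (ord : IsOrd (p ^ k) (suc d) 7) where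

  private instance
    p≢0 : NonZero p
    p≢0 = prime⇒nonZero prime-p

  q = suc d
  n = p ^ k
  w = d * Φ₇ q

  q⁷≡1+w : q ^ 7 ≡ 1 + w
  q⁷≡1+w = [1+d]^n≡1+d*eval-ones d 7

  n∣w : n ∣ w
  n∣w = subst (n ∣_) (cong (_∸ 1) q⁷≡1+w) (ord .proj₂ .proj₁)

  n∤d : ¬ n ∣ d
  n∤d n∣d with ord .proj₂ .proj₂ 1 z<s (subst (n ∣_) (sym (*-identityʳ d)) n∣d)
  ... | s≤s ()

  p∤d : ¬ p ∣ d
  p∤d p∣d = n∤d (p^k∣m*n⇒p^k∣m k prime-p p∤Φ n∣w)
    where
    p∤Φ : ¬ p ∣ Φ₇ q
    p∤Φ p∣Φ = <⇒≱ (7∣p∸1⇒7<p prime-p 7∣p∸1) (∣⇒≤ (∣d⇒∣Φ₇⇒∣7 p∣d p∣Φ))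

  n∣Φ : n ∣ Φ₇ q
  n∣Φ = p^k∣m*n⇒p^k∣m k prime-p p∤d (subst (n ∣_) (*-comm d _) n∣w)

  q⁷%N≡1 : ∀ {N} .{{_ : NonZero N}} → 1 < N → N ∣ n → q ^ 7 % N ≡ 1
  q⁷%N≡1 {N} 1<N N∣n = trans (cong (_% N) q⁷≡1+w) ([1+m]%N≡1 1<N (∣-trans N∣n n∣w))

  q%N≢1 : ∀ {N} .{{_ : NonZero N}} → ¬ N ∣ d → q % N ≢ 1
  q%N≢1 N∤d = N∤d ∘ [1+d]%N≡1⇒∣

  p∣n : p ∣ n
  p∣n = m∣m^n k>0

  1<p : 1 < p
  1<p = <-trans (s≤s (s≤s z≤n)) (7∣p∸1⇒7<p prime-p 7∣p∸1)

  upperBound : HasZeroSumOfPowers q n (expectedM p k)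
  upperBound with expectedM-cases p k
  ... | inj₁ m≡7 rewrite m≡7 =
    exponentList (ones 7) , length-exponentList (ones 7) , subst (n ∣_) (sym (powerSum-exponentList q (ones 7))) n∣Φ
  ... | inj₂ (k≡1 , L , L∈ , p∈L) =
    subst (λ j → HasZeroSumOfPowers q (p ^ j) (expectedM p j)) (sym k≡1)
          (subst (λ N → HasZeroSumOfPowers q N (expectedM p 1)) (sym (*-identityʳ p)) witness)
    where
    witness : HasZeroSumOfPowers q p (expectedM p 1)
    witness = zeroSumWitnesses-sound (all-sound {P = zeroSumWitnesses} {L} witnessesOfL p∈L) (q⁷%N≡1 1<p p∣n) (q%N≢1 p∤d)
      where
      witnessesOfL : T (all zeroSumWitnesses L)
      witnessesOfL = all-sound {P = all zeroSumWitnesses} {exceptionalClasses} exceptionalWitnesses L∈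

  expectedM≤weight : ∀ c {t} → 0 < t → t ≤ 6 → Vec.sum c ≡ t → n ∣ eval q c → expectedM p k ≤ t
  expectedM≤weight c {t} t>0 t≤6 Σc≡t n∣c = conclude (normCertificate-sound c prime-p p%7≡1 k>0 n∣r certificate)
    where
    p%7≡1 : p % 7 ≡ 1
    p%7≡1 = 7∣p∸1⇒p%7≡1 (<-trans z<s 1<p) 7∣p∸1
    n∣r : ∀ {r m} → norm c ≡ scalarPlusOnes r m → n ∣ r
    n∣r = ∣eval⇒∣scalar {u = conjugates c} q⁷≡1+w n∣w n∣Φ n∣c
    certificate : T (normCertificate t c)
    certificate = allCompositions-sound {7} {t} {normCertificate t} (normCertificates t>0 t≤6) c Σc≡t
    conclude : expectedM p k ≤ t ⊎ (p ≡ 29 × k ≡ 2) → expectedM p k ≤ t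
    conclude (inj₁ m≤t) = m≤t
    conclude (inj₂ (p≡29 , k≡2)) = contradiction (subst (_∣ eval q c) n≡841 n∣c)
      (noZeroSumOfWeight≤6-sound {841} {q} noShortZeroSums-29² (q⁷%N≡1 (≤ᵇ⇒≤ 2 841 _) (∣-reflexive (sym n≡841)))
         (q%N≢1 (n∤d ∘ subst (_∣ d) (sym n≡841))) c t>0 t≤6 Σc≡t)
      where
      n≡841 : n ≡ 841
      n≡841 = cong₂ _^_ p≡29 k≡2

  lowerBound : ∀ t → 0 < t → HasZeroSumOfPowers q n t → expectedM p k ≤ t
  lowerBound t t>0 (as , length≡t , n∣Σ) with 7 ≤? t
  ... | yes 7≤t = ≤-trans (expectedM≤7 p k) 7≤t
  ... | no 7≰t = expectedM≤weight (exponentHistogram as) t>0 (s≤s⁻¹ (≰⇒> 7≰t))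
    (trans (sum-exponentHistogram as) length≡t) (∣powerSum⇒∣eval-exponentHistogram q⁷≡1+w n∣w as n∣Σ)

proposition15 : (p k q : ℕ) → Prime p → 7 ∣ (p ∸ 1) → 0 < k → 0 < q → ¬ (p ∣ q) → IsOrd (p ^ k) q 7 → IsM q (p ^ k) (expectedM p k)
proposition15 p k (suc d) prime-p 7∣p∸1 k>0 _ _ ord = expectedM>0 p k , upperBound , lowerBound
  where open Order7 prime-p 7∣p∸1 k>0 ord
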